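{- Let $\oplus$ be a regular, associative sum on the class of all linear orders. If $1\oplus A\cong 1+A$ for all $A$, then $n\oplus A\cong n+A$ for all $A$ and all finite $n$; if $A\oplus 1\cong A+1$ for all $A$, then $A\oplus n\cong A+n$ for all $A$ and finite $n$; if $1\oplus A\cong A+1$ for all $A$, then $n\oplus A\cong A+n$ for all $A$ and finite $n$; and if $A\oplus 1\cong 1+A$ for all $A$, then $A\oplus n\cong n+A$ for all $A$ and finite $n$.
   Context: A sum $\oplus$ assigns to linear orders $A,B$ a linear order $A\oplus B$ that is the disjoint union of two suborders isomorphic to $A$ and $B$ (via specified embeddings). Regular: $A\cong A'$, $B\cong B'$ imply $A\oplus B\cong A'\oplus B'$. Associative: $A\oplus(B\oplus C)\cong(A\oplus B)\oplus C$. $n$ denotes the finite linear order with $n$ elements, $+$ the usual ordered sum. -}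

module Defs where

open import Level using (0ℓ)
open import Data.Nat using (ℕ)
open import Data.Fin using (Fin)
import Data.Fin as Fin
import Data.Fin.Properties as FinP
open import Data.Unit using (⊤; tt)
open import Data.Empty using (⊥)
import Data.Sum
open import Data.Sum using (_⊎_; inj₁; inj₂)
open import Data.Sum.Relation.Binary.LeftOrder using (_⊎-<_; ₁∼₁; ₁∼₂; ₂∼₂)
open import Data.Product using (Σ; _×_; _,_; ∃)
open import Function using (_⇔_; Bijective)
open import Relation.Binary.PropositionalEquality using (_≡_; refl; isEquivalence; cong)
open import Relation.Binary.Structures using (IsTotalOrder)
open import Relation.Nullary using (¬_)

record LinOrd : Set₁ where
  field
    Carrier : Set
    _≤_     : Carrier → Carrier → Set
    isTotalOrder : IsTotalOrder _≡_ _≤_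

open LinOrd public

record _≅_ (A B : LinOrd) : Set where
  field
    to        : Carrier A → Carrier B
    bijective : Bijective _≡_ _≡_ to
    monotone  : ∀ x y → (_≤_ A x y ⇔ _≤_ B (to x) (to y))

infix 4 _≅_

IsOrderEmbedding : (A B : LinOrd) → (Carrier A → Carrier B) → Set
IsOrderEmbedding A B f = ∀ x y → (_≤_ A x y ⇔ _≤_ B (f x) (f y))

record Sum : Set₁ where
  field
    _⊕_   : LinOrd → LinOrd → LinOrd
    ι₁    : ∀ A B → Carrier A → Carrier (A ⊕ B)
    ι₂    : ∀ A B → Carrier B → Carrier (A ⊕ B)
    ι₁-emb : ∀ A B → IsOrderEmbedding A (A ⊕ B) (ι₁ A B)
    ι₂-emb : ∀ A B → IsOrderEmbedding B (A ⊕ B) (ι₂ A B)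
    disjoint : ∀ A B (a : Carrier A) (b : Carrier B) → ¬ (ι₁ A B a ≡ ι₂ A B b)
    cover : ∀ A B (z : Carrier (A ⊕ B)) →
            (∃ λ a → ι₁ A B a ≡ z) ⊎ (∃ λ b → ι₂ A B b ≡ z)
  infixl 6 _⊕_

Regular : Sum → Set₁
Regular S = ∀ {A A′ B B′} → A ≅ A′ → B ≅ B′ → (A ⊕ B) ≅ (A′ ⊕ B′)
  where open Sum S

Associative : Sum → Set₁
Associative S = ∀ A B C → (A ⊕ (B ⊕ C)) ≅ ((A ⊕ B) ⊕ C)
  where open Sum S

_+_ : LinOrd → LinOrd → LinOrd
A + B = record
  { Carrier = Carrier A ⊎ Carrier B
  ; _≤_ = _⊎-<_ (_≤_ A) (_≤_ B)
  ; isTotalOrder = record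
    { isPartialOrder = record
      { isPreorder = record
        { isEquivalence = isEquivalence
        ; reflexive = λ { refl → rfl }
        ; trans = trn }
      ; antisym = asym }
    ; total = tot }
  }
  where
  module TA = IsTotalOrder (isTotalOrder A)
  module TB = IsTotalOrder (isTotalOrder B)
  R = _⊎-<_ (_≤_ A) (_≤_ B)
  rfl : ∀ {x} → R x x
  rfl {inj₁ a} = ₁∼₁ TA.refl
  rfl {inj₂ b} = ₂∼₂ TB.refl
  trn : ∀ {x y z} → R x y → R y z → R x z
  trn (₁∼₁ p) (₁∼₁ q) = ₁∼₁ (TA.trans p q)
  trn (₁∼₁ p) ₁∼₂ = ₁∼₂
  trn ₁∼₂ (₂∼₂ q) = ₁∼₂
  trn (₂∼₂ p) (₂∼₂ q) = ₂∼₂ (TB.trans p q)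
  asym : ∀ {x y} → R x y → R y x → x ≡ y
  asym (₁∼₁ p) (₁∼₁ q) = cong inj₁ (TA.antisym p q)
  asym (₂∼₂ p) (₂∼₂ q) = cong inj₂ (TB.antisym p q)
  tot : ∀ x y → R x y ⊎ R y x
  tot (inj₁ a) (inj₁ a′) = Data.Sum.map ₁∼₁ ₁∼₁ (TA.total a a′)
  tot (inj₁ a) (inj₂ b) = inj₁ ₁∼₂
  tot (inj₂ b) (inj₁ a) = inj₂ ₁∼₂
  tot (inj₂ b) (inj₂ b′) = Data.Sum.map ₂∼₂ ₂∼₂ (TB.total b b′)
infixl 6 _+_

fin : ℕ → LinOrd
fin n = record
  { Carrier = Fin n
  ; _≤_ = Fin._≤_
  ; isTotalOrder = FinP.≤-isTotalOrder
  }

{-# OPTIONS --safe #-}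
module Submission where

-- Induction on n: writing n + 1 ≅ 1 + n ≅ 1 ⊕ n (the hypothesis at A = n),
-- regularity and associativity turn (n + 1) ⊕ A into 1 ⊕ (n ⊕ A), to which the
-- induction hypothesis and then the hypothesis on 1 ⊕ - apply.  So any two regular
-- associative sums that agree on 1 ⊕ - agree on n ⊕ -.  The four statements are
-- instances of this: the ordered sum and its mirror (A, B) ↦ B + A are regular
-- associative sums, and mirroring ⊕ turns hypotheses on - ⊕ 1 into ones on 1 ⊕ -.

open import Level using (0ℓ) renaming (suc to lsuc)
open import Defs
open import Data.Nat using (ℕ; zero; suc)
import Data.Nat as ℕ
import Data.Nat.Properties as ℕ
open import Data.Fin using (toℕ; join; splitAt)
open import Data.Fin.Properties using (toℕ-↑ˡ; toℕ-↑ʳ; toℕ<n; join-splitAt; splitAt-join)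
open import Data.Product using (_×_; _,_; proj₁; proj₂; ∃)
open import Data.Sum as ⊎ using (inj₁; inj₂; assocˡ; assocʳ)
open import Data.Sum.Relation.Binary.LeftOrder using (₁∼₁; ₁∼₂; ₂∼₂)
open import Function using (_∘_; id; mk⇔; Equivalence; Injective)
open import Relation.Binary.Bundles using (Setoid)
open import Relation.Binary.Core using (_Preserves_⟶_)
open import Relation.Binary.Structures using (IsEquivalence; IsTotalOrder)
open import Relation.Binary.PropositionalEquality
  using (_≡_; refl; sym; trans; cong; subst₂)
import Relation.Binary.Reasoning.Setoid as SetoidReasoning

module _ {A B : LinOrd} where
  private
    module A = IsTotalOrder (isTotalOrder A)
    module B = IsTotalOrder (isTotalOrder B)

  embedding-injective : ∀ {f} → IsOrderEmbedding A B f → Injective _≡_ _≡_ f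
  embedding-injective {f} emb {x} {y} fx≡fy = A.antisym
    (Equivalence.from (emb x y) (B.reflexive fx≡fy))
    (Equivalence.from (emb y x) (B.reflexive (sym fx≡fy)))

  monotone-injective⇒embedding : ∀ {f} → f Preserves _≤_ A ⟶ _≤_ B →
                                 Injective _≡_ _≡_ f → IsOrderEmbedding A B f
  monotone-injective⇒embedding {f} mono inj x y = mk⇔ mono reflect
    where
    reflect : _≤_ B (f x) (f y) → _≤_ A x y
    reflect fx≤fy with A.total x y
    ... | inj₁ x≤y = x≤y
    ... | inj₂ y≤x = A.reflexive (inj (B.antisym fx≤fy (mono y≤x)))

  monotone-inverse⇒≅ : (f : Carrier A → Carrier B) (g : Carrier B → Carrier A) →
                       f Preserves _≤_ A ⟶ _≤_ B →
                       (∀ x → g (f x) ≡ x) → (∀ y → f (g y) ≡ y) → A ≅ B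
  monotone-inverse⇒≅ f g mono g∘f f∘g = record
    { to        = f
    ; bijective = injective , λ y → g y , λ { refl → f∘g y }
    ; monotone  = monotone-injective⇒embedding mono injective
    }
    where
    injective : Injective _≡_ _≡_ f
    injective {x} {y} fx≡fy = trans (sym (g∘f x)) (trans (cong g fx≡fy) (g∘f y))

module Iso {A B : LinOrd} (i : A ≅ B) where
  open _≅_ i public

  from : Carrier B → Carrier A
  from y = proj₁ (proj₂ bijective y)

  to∘from : ∀ y → to (from y) ≡ y
  to∘from y = proj₂ (proj₂ bijective y) refl

  from∘to : ∀ x → from (to x) ≡ x
  from∘to x = proj₁ bijective (to∘from (to x))

  to-mono : to Preserves _≤_ A ⟶ _≤_ B
  to-mono = Equivalence.to (monotone _ _)

  from-mono : from Preserves _≤_ B ⟶ _≤_ A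
  from-mono {x} {y} x≤y = Equivalence.from (monotone (from x) (from y))
    (subst₂ (_≤_ B) (sym (to∘from x)) (sym (to∘from y)) x≤y)

≅-refl : ∀ {A} → A ≅ A
≅-refl = monotone-inverse⇒≅ id id id (λ _ → refl) (λ _ → refl)

≅-sym : ∀ {A B} → A ≅ B → B ≅ A
≅-sym i = monotone-inverse⇒≅ from to from-mono to∘from from∘to
  where open Iso i

≅-trans : ∀ {A B C} → A ≅ B → B ≅ C → A ≅ C
≅-trans i j = monotone-inverse⇒≅ (J.to ∘ I.to) (I.from ∘ J.from)
  (λ x≤y → J.to-mono (I.to-mono x≤y))
  (λ x → trans (cong I.from (J.from∘to (I.to x))) (I.from∘to x))
  (λ z → trans (cong J.to (I.to∘from (J.from z))) (J.to∘from z))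
  where
  module I = Iso i
  module J = Iso j

≅-isEquivalence : IsEquivalence _≅_
≅-isEquivalence = record { refl = ≅-refl ; sym = ≅-sym ; trans = ≅-trans }

≅-setoid : Setoid (lsuc 0ℓ) 0ℓ
≅-setoid = record { isEquivalence = ≅-isEquivalence }

open SetoidReasoning ≅-setoid

module _ (S : Sum) where
  open Sum S

  ⊕-identityˡ : ∀ A → fin 0 ⊕ A ≅ A
  ⊕-identityˡ A = ≅-sym (monotone-inverse⇒≅ (ι₂ (fin 0) A) (proj₁ ∘ preimage)
    (Equivalence.to (ι₂-emb (fin 0) A _ _))
    (λ a → ι₂-injective (proj₂ (preimage (ι₂ (fin 0) A a))))
    (proj₂ ∘ preimage))
    where
    ι₂-injective : Injective _≡_ _≡_ (ι₂ (fin 0) A)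
    ι₂-injective = embedding-injective {A} {fin 0 ⊕ A} (ι₂-emb (fin 0) A)

    preimage : ∀ z → ∃ λ a → ι₂ (fin 0) A a ≡ z
    preimage z with cover (fin 0) A z
    ... | inj₁ (() , _)
    ... | inj₂ found = found

flipped : Sum → Sum
flipped S = record
  { _⊕_      = λ A B → B ⊕ A
  ; ι₁       = λ A B → ι₂ B A
  ; ι₂       = λ A B → ι₁ B A
  ; ι₁-emb   = λ A B → ι₂-emb B A
  ; ι₂-emb   = λ A B → ι₁-emb B A
  ; disjoint = λ A B a b eq → disjoint B A b a (sym eq)
  ; cover    = λ A B z → ⊎.swap (cover B A z)
  }
  where open Sum S

flipped-regular : ∀ S → Regular S → Regular (flipped S)
flipped-regular S reg i j = reg j i

flipped-associative : ∀ S → Associative S → Associative (flipped S)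
flipped-associative S assoc A B C = ≅-sym (assoc C B A)

ordered-sum : Sum
ordered-sum = record
  { _⊕_      = _+_
  ; ι₁       = λ _ _ → inj₁
  ; ι₂       = λ _ _ → inj₂
  ; ι₁-emb   = λ _ _ _ _ → mk⇔ ₁∼₁ λ { (₁∼₁ p) → p }
  ; ι₂-emb   = λ _ _ _ _ → mk⇔ ₂∼₂ λ { (₂∼₂ p) → p }
  ; disjoint = λ _ _ _ _ ()
  ; cover    = λ { _ _ (inj₁ a) → inj₁ (a , refl) ; _ _ (inj₂ b) → inj₂ (b , refl) }
  }

+-cong : Regular ordered-sum
+-cong {A} {A′} {B} {B′} i j = monotone-inverse⇒≅
  (⊎.map I.to J.to) (⊎.map I.from J.from) map-mono
  (λ { (inj₁ a) → cong inj₁ (I.from∘to a) ; (inj₂ b) → cong inj₂ (J.from∘to b) })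
  (λ { (inj₁ a) → cong inj₁ (I.to∘from a) ; (inj₂ b) → cong inj₂ (J.to∘from b) })
  where
  module I = Iso i
  module J = Iso j
  map-mono : ⊎.map I.to J.to Preserves _≤_ (A + B) ⟶ _≤_ (A′ + B′)
  map-mono (₁∼₁ p) = ₁∼₁ (I.to-mono p)
  map-mono ₁∼₂     = ₁∼₂
  map-mono (₂∼₂ p) = ₂∼₂ (J.to-mono p)

+-assoc : Associative ordered-sum
+-assoc A B C = monotone-inverse⇒≅ assocˡ assocʳ assocˡ-mono
  (λ { (inj₁ a) → refl ; (inj₂ (inj₁ b)) → refl ; (inj₂ (inj₂ c)) → refl })
  (λ { (inj₁ (inj₁ a)) → refl ; (inj₁ (inj₂ b)) → refl ; (inj₂ c) → refl })
  where
  assocˡ-mono : assocˡ Preserves _≤_ (A + (B + C)) ⟶ _≤_ ((A + B) + C)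
  assocˡ-mono (₁∼₁ p)                     = ₁∼₁ (₁∼₁ p)
  assocˡ-mono {_} {inj₂ (inj₁ _)} ₁∼₂     = ₁∼₁ ₁∼₂
  assocˡ-mono {_} {inj₂ (inj₂ _)} ₁∼₂     = ₁∼₂
  assocˡ-mono (₂∼₂ (₁∼₁ p))               = ₁∼₁ (₂∼₂ p)
  assocˡ-mono (₂∼₂ ₁∼₂)                   = ₁∼₂
  assocˡ-mono (₂∼₂ (₂∼₂ p))               = ₂∼₂ p

fin-+ : ∀ m n → fin m + fin n ≅ fin (m ℕ.+ n)
fin-+ m n = monotone-inverse⇒≅ (join m n) (splitAt m) join-mono
  (splitAt-join m n) (join-splitAt m n)
  where
  join-mono : join m n Preserves _≤_ (fin m + fin n) ⟶ _≤_ (fin (m ℕ.+ n))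
  join-mono (₁∼₁ {i} {j} i≤j) = subst₂ ℕ._≤_ (sym (toℕ-↑ˡ i n)) (sym (toℕ-↑ˡ j n)) i≤j
  join-mono (₁∼₂ {i} {j}) = subst₂ ℕ._≤_ (sym (toℕ-↑ˡ i n)) (sym (toℕ-↑ʳ m j))
    (ℕ.≤-trans (ℕ.<⇒≤ (toℕ<n i)) (ℕ.m≤m+n m (toℕ j)))
  join-mono (₂∼₂ {i} {j} i≤j) = subst₂ ℕ._≤_ (sym (toℕ-↑ʳ m i)) (sym (toℕ-↑ʳ m j))
    (ℕ.+-monoʳ-≤ m i≤j)

fin-suc≅1+fin : ∀ n → fin (suc n) ≅ fin 1 + fin n
fin-suc≅1+fin n = ≅-sym (fin-+ 1 n)

fin-suc≅fin+1 : ∀ n → fin (suc n) ≅ fin n + fin 1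
fin-suc≅fin+1 n = begin
  fin (suc n)     ≡⟨ cong fin (ℕ.+-comm 1 n) ⟩
  fin (n ℕ.+ 1)   ≈⟨ fin-+ n 1 ⟨
  fin n + fin 1   ∎

module _ (S T : Sum) (regˢ : Regular S) (assocˢ : Associative S)
         (regᵗ : Regular T) (assocᵗ : Associative T) where
  open Sum S using () renaming (_⊕_ to infixl 6 _⊕ˢ_)
  open Sum T using () renaming (_⊕_ to infixl 6 _⊕ᵗ_)

  agree-on-1⇒agree-on-fin : (∀ n → fin (suc n) ≅ fin 1 ⊕ᵗ fin n) →
    (∀ A → fin 1 ⊕ˢ A ≅ fin 1 ⊕ᵗ A) → ∀ n A → fin n ⊕ˢ A ≅ fin n ⊕ᵗ A
  agree-on-1⇒agree-on-fin split one zero A = begin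
    fin 0 ⊕ˢ A  ≈⟨ ⊕-identityˡ S A ⟩
    A           ≈⟨ ⊕-identityˡ T A ⟨
    fin 0 ⊕ᵗ A  ∎
  agree-on-1⇒agree-on-fin split one (suc n) A = begin
    fin (suc n) ⊕ˢ A       ≈⟨ regˢ (split n) ≅-refl ⟩
    (fin 1 ⊕ᵗ fin n) ⊕ˢ A  ≈⟨ regˢ (one (fin n)) ≅-refl ⟨
    (fin 1 ⊕ˢ fin n) ⊕ˢ A  ≈⟨ assocˢ (fin 1) (fin n) A ⟨
    fin 1 ⊕ˢ (fin n ⊕ˢ A)  ≈⟨ regˢ ≅-refl (agree-on-1⇒agree-on-fin split one n A) ⟩
    fin 1 ⊕ˢ (fin n ⊕ᵗ A)  ≈⟨ one (fin n ⊕ᵗ A) ⟩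
    fin 1 ⊕ᵗ (fin n ⊕ᵗ A)  ≈⟨ assocᵗ (fin 1) (fin n) A ⟩
    (fin 1 ⊕ᵗ fin n) ⊕ᵗ A  ≈⟨ regᵗ (split n) ≅-refl ⟨
    fin (suc n) ⊕ᵗ A       ∎

mainTheorem17 : (S : Sum) → Regular S → Associative S →
    (((∀ A → Sum._⊕_ S (fin 1) A ≅ fin 1 + A) → ∀ (n : ℕ) A → Sum._⊕_ S (fin n) A ≅ fin n + A)
    × ((∀ A → Sum._⊕_ S A (fin 1) ≅ A + fin 1) → ∀ (n : ℕ) A → Sum._⊕_ S A (fin n) ≅ A + fin n)
    × ((∀ A → Sum._⊕_ S (fin 1) A ≅ A + fin 1) → ∀ (n : ℕ) A → Sum._⊕_ S (fin n) A ≅ A + fin n)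
    × ((∀ A → Sum._⊕_ S A (fin 1) ≅ fin 1 + A) → ∀ (n : ℕ) A → Sum._⊕_ S A (fin n) ≅ fin n + A))
mainTheorem17 S reg assoc =
    agree-on-1⇒agree-on-fin S ordered-sum reg assoc +-cong +-assoc fin-suc≅1+fin
  , agree-on-1⇒agree-on-fin (flipped S) (flipped ordered-sum) reg′ assoc′ +-cong′ +-assoc′ fin-suc≅fin+1
  , agree-on-1⇒agree-on-fin S (flipped ordered-sum) reg assoc +-cong′ +-assoc′ fin-suc≅fin+1
  , agree-on-1⇒agree-on-fin (flipped S) ordered-sum reg′ assoc′ +-cong +-assoc fin-suc≅1+fin
  where
  reg′ : Regular (flipped S)
  reg′ = flipped-regular S reg
  assoc′ : Associative (flipped S)
  assoc′ = flipped-associative S assoc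
  +-cong′ : Regular (flipped ordered-sum)
  +-cong′ = flipped-regular ordered-sum +-cong
  +-assoc′ : Associative (flipped ordered-sum)
  +-assoc′ = flipped-associative ordered-sum +-assoc
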